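{- Let $n,k$ be positive integers with $k\le n$. There is a bijection \[\sigma:\{\mathbf{x}\in\mathrm{PF}^\uparrow_{n,n}:x_n\le k\}\to\mathrm{SYT}(n,k-1).\]
   Context: $\mathrm{PF}^\uparrow_{n,n}$ is the set of nondecreasing tuples $\mathbf{x}=(x_1,\ldots,x_n)$ of positive integers with $x_j\le j$ for all $j\in[n]$ (nondecreasing parking functions). For integers $a\ge b\ge0$, $\mathrm{SYT}(a,b)$ is the set of standard Young tableaux of shape $(a,b)$. -}

module Defs where

open import Data.Nat using (ℕ; zero; suc; _+_; _≤_; _<_)
open import Data.Fin using (Fin; toℕ) renaming (_≤_ to _≤ᶠ_; _<_ to _<ᶠ_)
open import Data.Vec using (Vec; []; _∷_; lookup; last; _++_)
open import Data.Product using (Σ; ∃; _×_; proj₁)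
open import Data.Unit using (⊤)
open import Relation.Binary.PropositionalEquality using (_≡_)
open import Relation.Binary.Bundles using (Setoid)
open import Relation.Binary.PropositionalEquality.Properties using (setoid)
open import Relation.Binary.Construct.On as On using ()
open import Level using (0ℓ)

-- x = (x₁,…,xₙ) stored as a vector; position i : Fin n is index toℕ i + 1.
-- Nondecreasing parking function: positive entries, x_j ≤ j, nondecreasing.
IsNDPF : ∀ {n} → Vec ℕ n → Set
IsNDPF {n} x =
  (∀ (i : Fin n) → 1 ≤ lookup x i) ×
  (∀ (i : Fin n) → lookup x i ≤ suc (toℕ i)) ×
  (∀ (i j : Fin n) → i ≤ᶠ j → lookup x i ≤ lookup x j)

-- "x_n ≤ k" (only used for n ≥ 1; trivially true for the empty tuple)
Last≤ : ∀ {n} → Vec ℕ n → ℕ → Set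
Last≤ [] k = ⊤
Last≤ (y ∷ ys) k = last (y ∷ ys) ≤ k

PFup≤ : ℕ → ℕ → Set
PFup≤ n k = Σ (Vec ℕ n) λ x → IsNDPF x × Last≤ x k

-- Standard Young tableau of shape (a,b) (English notation):
-- first row r₁ (length a), second row r₂ (length b), each of 1,…,a+b
-- occurring exactly once, rows strictly increasing left to right,
-- columns strictly increasing top to bottom.
IsSYT : (a b : ℕ) → Vec ℕ a → Vec ℕ b → Set
IsSYT a b r₁ r₂ =
  (∀ (i : Fin (a + b)) → 1 ≤ lookup (r₁ ++ r₂) i × lookup (r₁ ++ r₂) i ≤ a + b) ×
  (∀ (i j : Fin (a + b)) → lookup (r₁ ++ r₂) i ≡ lookup (r₁ ++ r₂) j → i ≡ j) ×
  (∀ (v : ℕ) → 1 ≤ v → v ≤ a + b → ∃ λ (i : Fin (a + b)) → lookup (r₁ ++ r₂) i ≡ v) ×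
  (∀ (i j : Fin a) → i <ᶠ j → lookup r₁ i < lookup r₁ j) ×
  (∀ (i j : Fin b) → i <ᶠ j → lookup r₂ i < lookup r₂ j) ×
  (∀ (i : Fin a) (j : Fin b) → toℕ i ≡ toℕ j → lookup r₁ i < lookup r₂ j)

SYT : ℕ → ℕ → Set
SYT a b = Σ (Vec ℕ a × Vec ℕ b) λ r → IsSYT a b (proj₁ r) (Data.Product.proj₂ r)

PFup≤-setoid : ℕ → ℕ → Setoid 0ℓ 0ℓ
PFup≤-setoid n k = record
  { Carrier = PFup≤ n k
  ; _≈_ = λ x y → proj₁ x ≡ proj₁ y
  ; isEquivalence = On.isEquivalence proj₁ (Setoid.isEquivalence (setoid (Vec ℕ n)))
  }

SYT-setoid : ℕ → ℕ → Setoid 0ℓ 0ℓ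
SYT-setoid a b = record
  { Carrier = SYT a b
  ; _≈_ = λ s t → proj₁ s ≡ proj₁ t
  ; isEquivalence = On.isEquivalence proj₁ (Setoid.isEquivalence (setoid (Vec ℕ a × Vec ℕ b)))
  }

{-# OPTIONS --safe #-}
module Submission where

-- For a nondecreasing parking function x the numbers (i − 1) + xᵢ strictly increase; they form
-- the first row, and the second row lists the rest of {1, …, n + k − 1} increasingly, its j-th
-- entry being j + #{i : xᵢ ≤ j}.  Comparing xᵢ with j tells which of the entries in columns i
-- and j is smaller, so the rows are disjoint, and xᵢ ≤ i is exactly the column condition in
-- column i.  Conversely, in a tableau every value up to the i-th entry rᵢ of the first row sits
-- in the first i columns of row 1 or the first i − 1 columns of row 2, so rᵢ ≤ 2i − 1 and
-- xᵢ := rᵢ − (i − 1) ≤ i.  As both rows increase, the second row is the increasing enumeration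
-- of the complement of the first, so the first row, hence x, determines the tableau.

open import Defs
open import Data.Empty using (⊥-elim)
open import Data.Fin using (Fin; zero; suc; toℕ; fromℕ; fromℕ<; _↑ˡ_; _↑ʳ_; punchOut)
  renaming (_≤_ to _≤ᶠ_; _<_ to _<ᶠ_)
open import Data.Fin.Induction using (<-wellFounded)
import Data.Fin.Properties as Finₚ
open import Data.Nat using (ℕ; zero; suc; _+_; _∸_; _≤_; _<_; _≤?_; z≤n; s≤s; s≤s⁻¹; z<s)
open import Data.Nat.Properties
open import Data.Product using (∃; _×_; _,_; proj₁; proj₂)
open import Data.Sum using (_⊎_; inj₁; inj₂)
open import Data.Vec using (Vec; []; _∷_; lookup; last; tabulate; _++_; count)
open import Data.Vec.Properties using (lookup∘tabulate; lookup-++ˡ; lookup-++ʳ; count≤n)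
open import Data.Vec.Relation.Binary.Pointwise.Extensional using (ext; Pointwise-≡⇒≡)
open import Data.Vec.Relation.Unary.All.Properties using (lookup⁺; tabulate⁺; ++⁺)
open import Function.Base using (_∘_)
open import Function.Bundles using (Bijection)
open import Function.Definitions using (Injective)
open import Induction.WellFounded using (Acc; acc)
open import Level using (0ℓ)
open import Relation.Nullary using (¬_; yes; no; contradiction)
open import Relation.Unary using (Pred; Decidable; _⊆_)
open import Relation.Binary.PropositionalEquality
  using (_≡_; _≢_; refl; sym; trans; cong; cong₂; subst; subst₂; module ≡-Reasoning)

private
  variable
    a b m n : ℕ

data Split (m n : ℕ) : Fin (m + n) → Set where
  left  : (i : Fin m) → Split m n (i ↑ˡ n)
  right : (j : Fin n) → Split m n (m ↑ʳ j)

split : ∀ m n (p : Fin (m + n)) → Split m n p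
split zero    n p       = right p
split (suc m) n zero    = left zero
split (suc m) n (suc p) with split m n p
... | left i  = left (suc i)
... | right j = right j

↑ˡ≢↑ʳ : (i : Fin m) (j : Fin n) → i ↑ˡ n ≢ m ↑ʳ j
↑ˡ≢↑ʳ (suc i) j eq = ↑ˡ≢↑ʳ i j (Finₚ.suc-injective eq)

module _ {A : Set} (xs : Vec A m) (ys : Vec A n) where

  ++-injective : Injective _≡_ _≡_ (lookup xs) → Injective _≡_ _≡_ (lookup ys) →
                 (∀ i j → lookup xs i ≢ lookup ys j) → Injective _≡_ _≡_ (lookup (xs ++ ys))
  ++-injective xs-inj ys-inj disjoint {p} {q} eq with split m n p | split m n q
  ... | left i  | left i′  = cong (_↑ˡ n) (xs-inj (subst₂ _≡_ (lookup-++ˡ xs ys i) (lookup-++ˡ xs ys i′) eq))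
  ... | right j | right j′ = cong (m ↑ʳ_) (ys-inj (subst₂ _≡_ (lookup-++ʳ xs ys j) (lookup-++ʳ xs ys j′) eq))
  ... | left i  | right j  = ⊥-elim (disjoint i j (subst₂ _≡_ (lookup-++ˡ xs ys i) (lookup-++ʳ xs ys j) eq))
  ... | right j | left i   = ⊥-elim (disjoint i j (subst₂ _≡_ (lookup-++ˡ xs ys i) (lookup-++ʳ xs ys j) (sym eq)))

  ++-injective⇒disjoint : Injective _≡_ _≡_ (lookup (xs ++ ys)) → ∀ i j → lookup xs i ≢ lookup ys j
  ++-injective⇒disjoint inj i j eq =
    ↑ˡ≢↑ʳ i j (inj (subst₂ _≡_ (sym (lookup-++ˡ xs ys i)) (sym (lookup-++ʳ xs ys j)) eq))

  ++-location : ∀ {v} → (∃ λ p → lookup (xs ++ ys) p ≡ v) →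
                (∃ λ i → lookup xs i ≡ v) ⊎ (∃ λ j → lookup ys j ≡ v)
  ++-location (p , eq) with split m n p
  ... | left i  = inj₁ (i , trans (sym (lookup-++ˡ xs ys i)) eq)
  ... | right j = inj₂ (j , trans (sym (lookup-++ʳ xs ys j)) eq)

Nondecreasing : (Fin m → ℕ) → Set
Nondecreasing f = ∀ i j → i ≤ᶠ j → f i ≤ f j

StrictlyIncreasing : (Fin m → ℕ) → Set
StrictlyIncreasing f = ∀ i j → i <ᶠ j → f i < f j

module _ {f : Fin m → ℕ} (f↑ : StrictlyIncreasing f) where

  strictlyIncreasing-cancel-≤ : ∀ i j → f i ≤ f j → i ≤ᶠ j
  strictlyIncreasing-cancel-≤ i j fi≤fj = ≮⇒≥ (λ j<i → <⇒≱ (f↑ j i j<i) fi≤fj)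

  strictlyIncreasing⇒injective : Injective _≡_ _≡_ f
  strictlyIncreasing⇒injective {i} {j} eq = Finₚ.≤-antisym
    (strictlyIncreasing-cancel-≤ i j (≤-reflexive eq))
    (strictlyIncreasing-cancel-≤ j i (≤-reflexive (sym eq)))

  strictlyIncreasing⇒nondecreasing : Nondecreasing f
  strictlyIncreasing⇒nondecreasing i j i≤j with m≤n⇒m<n∨m≡n i≤j
  ... | inj₁ i<j = <⇒≤ (f↑ i j i<j)
  ... | inj₂ i≡j = ≤-reflexive (cong f (Finₚ.toℕ-injective i≡j))

strictlyIncreasing-tail : {f : Fin (suc m) → ℕ} → StrictlyIncreasing f → StrictlyIncreasing (f ∘ suc)
strictlyIncreasing-tail f↑ i j i<j = f↑ (suc i) (suc j) (s≤s i<j)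

strictlyIncreasing-gap : {f : Fin m → ℕ} → StrictlyIncreasing f →
                         ∀ i j → i ≤ᶠ j → toℕ j + f i ≤ toℕ i + f j
strictlyIncreasing-gap f↑ zero    zero          _         = ≤-refl
strictlyIncreasing-gap f↑ zero    (suc zero)    _         = f↑ zero (suc zero) z<s
strictlyIncreasing-gap {f = f} f↑ zero (suc (suc j)) _ = begin
  suc (suc (toℕ j)) + f zero   ≡⟨ +-suc (suc (toℕ j)) (f zero) ⟨
  suc (toℕ j) + suc (f zero)   ≤⟨ +-monoʳ-≤ (suc (toℕ j)) (f↑ zero (suc zero) z<s) ⟩
  suc (toℕ j) + f (suc zero)   ≤⟨ strictlyIncreasing-gap (strictlyIncreasing-tail f↑) zero (suc j) z≤n ⟩
  f (suc (suc j))              ∎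
  where open ≤-Reasoning
strictlyIncreasing-gap f↑ (suc i) (suc j) (s≤s i≤j) =
  s≤s (strictlyIncreasing-gap (strictlyIncreasing-tail f↑) i j i≤j)

strictlyIncreasing-head+toℕ≤ : {f : Fin (suc m) → ℕ} → StrictlyIncreasing f → ∀ i → f zero + toℕ i ≤ f i
strictlyIncreasing-head+toℕ≤ {f = f} f↑ i =
  ≤-trans (≤-reflexive (+-comm (f zero) (toℕ i))) (strictlyIncreasing-gap f↑ zero i z≤n)

+toℕ-strictlyIncreasing : {h : Fin m → ℕ} → Nondecreasing h → StrictlyIncreasing (λ i → toℕ i + h i)
+toℕ-strictlyIncreasing h↑ i j i<j = +-mono-<-≤ i<j (h↑ i j (<⇒≤ i<j))

∸toℕ-nondecreasing : {f : Fin m → ℕ} → StrictlyIncreasing f → Nondecreasing (λ i → f i ∸ toℕ i)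
∸toℕ-nondecreasing {f = f} f↑ i j i≤j = begin
  f i ∸ toℕ i                    ≡⟨ [m+n]∸[m+o]≡n∸o (toℕ j) (f i) (toℕ i) ⟨
  toℕ j + f i ∸ (toℕ j + toℕ i)  ≤⟨ ∸-monoˡ-≤ (toℕ j + toℕ i) (strictlyIncreasing-gap f↑ i j i≤j) ⟩
  toℕ i + f j ∸ (toℕ j + toℕ i)  ≡⟨ cong (toℕ i + f j ∸_) (+-comm (toℕ j) (toℕ i)) ⟩
  toℕ i + f j ∸ (toℕ i + toℕ j)  ≡⟨ [m+n]∸[m+o]≡n∸o (toℕ i) (f j) (toℕ j) ⟩
  f j ∸ toℕ j                    ∎
  where open ≤-Reasoning

private
  ≤-ifAgreeingBelow : {f g : Fin m → ℕ} → StrictlyIncreasing f → StrictlyIncreasing g → ∀ j →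
                      (∀ i → i <ᶠ j → f i ≡ g i) → (∃ λ i → g i ≡ f j) → g j ≤ f j
  ≤-ifAgreeingBelow f↑ g↑ j agree (i , gi≡fj) with i Finₚ.<? j
  ... | yes i<j = contradiction (trans (agree i i<j) gi≡fj) (<⇒≢ (f↑ i j i<j))
  ... | no  i≮j = ≤-trans (strictlyIncreasing⇒nondecreasing g↑ j i (≮⇒≥ i≮j)) (≤-reflexive gi≡fj)

sameImage⇒≗ : {f g : Fin m → ℕ} → StrictlyIncreasing f → StrictlyIncreasing g →
              (∀ j → ∃ λ i → g i ≡ f j) → (∀ j → ∃ λ i → f i ≡ g j) → ∀ j → f j ≡ g j
sameImage⇒≗ {f = f} {g} f↑ g↑ g⊇f f⊇g j = agreeAt j (<-wellFounded j)
  where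
  agreeAt : ∀ j → Acc _<ᶠ_ j → f j ≡ g j
  agreeAt j (acc below) = ≤-antisym
    (≤-ifAgreeingBelow g↑ f↑ j (λ i i<j → sym (agreeAt i (below i<j))) (f⊇g j))
    (≤-ifAgreeingBelow f↑ g↑ j (λ i i<j → agreeAt i (below i<j)) (g⊇f j))

injective∧bounded⇒≤ : ∀ {k} (f : Fin m → ℕ) → Injective _≡_ _≡_ f → (∀ i → f i < k) → m ≤ k
injective∧bounded⇒≤ f f-inj f<k = Finₚ.injective⇒≤ {f = λ i → fromℕ< (f<k i)} λ eq →
  f-inj (trans (sym (Finₚ.toℕ-fromℕ< (f<k _))) (trans (cong toℕ eq) (Finₚ.toℕ-fromℕ< (f<k _))))

injective⇒surjective : {f : Fin n → Fin n} → Injective _≡_ _≡_ f → ∀ v → ∃ λ i → f i ≡ v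
injective⇒surjective {suc n} {f} f-inj v with Finₚ.any? (λ i → f i Finₚ.≟ v)
... | yes hit = hit
... | no miss = contradiction (Finₚ.injective⇒≤ avoid-injective) 1+n≰n
  where
  v≢f : ∀ i → v ≢ f i
  v≢f i v≡fi = miss (i , sym v≡fi)

  avoid : Fin (suc n) → Fin n
  avoid i = punchOut (v≢f i)

  avoid-injective : Injective _≡_ _≡_ avoid
  avoid-injective {i} {j} eq = f-inj (Finₚ.punchOut-injective (v≢f i) (v≢f j) eq)

positive⇒suc-toℕ : ∀ {v} → 1 ≤ v → v ≤ n → ∃ λ (q : Fin n) → suc (toℕ q) ≡ v
positive⇒suc-toℕ {v = suc v} _ v<n = fromℕ< v<n , cong suc (Finₚ.toℕ-fromℕ< v<n)

injective⇒surjectiveOn[1,n] : (f : Fin n → ℕ) → Injective _≡_ _≡_ f → (∀ i → 1 ≤ f i × f i ≤ n) →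
                              ∀ v → 1 ≤ v → v ≤ n → ∃ λ i → f i ≡ v
injective⇒surjectiveOn[1,n] {n} f f-inj f-range v 1≤v v≤n = i , (begin
  f i                ≡⟨ suc-toℕ-g i ⟨
  suc (toℕ (g i))    ≡⟨ cong (suc ∘ toℕ) gi≡q ⟩
  suc (toℕ q)        ≡⟨ suc-toℕ-q ⟩
  v                  ∎)
  where
  open ≡-Reasoning
  g : Fin n → Fin n
  g i = proj₁ (positive⇒suc-toℕ (proj₁ (f-range i)) (proj₂ (f-range i)))

  suc-toℕ-g : ∀ i → suc (toℕ (g i)) ≡ f i
  suc-toℕ-g i = proj₂ (positive⇒suc-toℕ (proj₁ (f-range i)) (proj₂ (f-range i)))

  g-injective : Injective _≡_ _≡_ g
  g-injective {i} {j} eq = f-inj (trans (sym (suc-toℕ-g i)) (trans (cong (suc ∘ toℕ) eq) (suc-toℕ-g j)))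

  q : Fin n
  q = proj₁ (positive⇒suc-toℕ 1≤v v≤n)

  suc-toℕ-q : suc (toℕ q) ≡ v
  suc-toℕ-q = proj₂ (positive⇒suc-toℕ 1≤v v≤n)

  i : Fin n
  i = proj₁ (injective⇒surjective g-injective q)

  gi≡q : g i ≡ q
  gi≡q = proj₂ (injective⇒surjective g-injective q)

module _ {A : Set} {P : Pred A 0ℓ} (P? : Decidable P) where

  count-monotone : {Q : Pred A 0ℓ} (Q? : Decidable Q) → P ⊆ Q → (xs : Vec A n) → count P? xs ≤ count Q? xs
  count-monotone Q? P⊆Q []       = z≤n
  count-monotone Q? P⊆Q (y ∷ ys) with P? y | Q? y
  ... | yes _  | yes _  = s≤s (count-monotone Q? P⊆Q ys)
  ... | yes py | no ¬qy = contradiction (P⊆Q py) ¬qy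
  ... | no _   | yes _  = m≤n⇒m≤1+n (count-monotone Q? P⊆Q ys)
  ... | no _   | no _   = count-monotone Q? P⊆Q ys

  holdsUpTo⇒<count : (xs : Vec A n) (i : Fin n) → (∀ j → j ≤ᶠ i → P (lookup xs j)) → toℕ i < count P? xs
  holdsUpTo⇒<count (y ∷ ys) zero holds with P? y
  ... | yes _  = s≤s z≤n
  ... | no ¬py = contradiction (holds zero z≤n) ¬py
  holdsUpTo⇒<count (y ∷ ys) (suc i) holds with P? y
  ... | yes _  = s≤s (holdsUpTo⇒<count ys i (λ j j≤i → holds (suc j) (s≤s j≤i)))
  ... | no ¬py = contradiction (holds zero z≤n) ¬py

  failsFrom⇒count≤ : (xs : Vec A n) (k : ℕ) → (∀ j → k ≤ toℕ j → ¬ P (lookup xs j)) → count P? xs ≤ k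
  failsFrom⇒count≤ []       k       _     = z≤n
  failsFrom⇒count≤ (y ∷ ys) zero    fails with P? y
  ... | yes py = contradiction py (fails zero z≤n)
  ... | no _   = failsFrom⇒count≤ ys zero (λ j _ → fails (suc j) z≤n)
  failsFrom⇒count≤ (y ∷ ys) (suc k) fails with P? y
  ... | yes _  = s≤s (failsFrom⇒count≤ ys k (λ j k≤j → fails (suc j) (s≤s k≤j)))
  ... | no _   = m≤n⇒m≤1+n (failsFrom⇒count≤ ys k (λ j k≤j → fails (suc j) (s≤s k≤j)))

countAtMost : ℕ → Vec ℕ n → ℕ
countAtMost t = count (_≤? t)

tabulate-isSYT : {f : Fin a → ℕ} {g : Fin b → ℕ} →
                 (∀ i → 1 ≤ f i × f i ≤ a + b) → (∀ j → 1 ≤ g j × g j ≤ a + b) →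
                 StrictlyIncreasing f → StrictlyIncreasing g → (∀ i j → f i ≢ g j) →
                 (∀ i j → toℕ i ≡ toℕ j → f i < g j) → IsSYT a b (tabulate f) (tabulate g)
tabulate-isSYT {a} {b} {f} {g} f-range g-range f↑ g↑ disjoint columns =
  range , (λ _ _ → injective) , injective⇒surjectiveOn[1,n] _ injective range , row₁↑ , row₂↑ ,
  λ i j i≡j → subst₂ _<_ (f≡ i) (g≡ j) (columns i j i≡j)
  where
  f≡ : ∀ i → f i ≡ lookup (tabulate f) i
  f≡ i = sym (lookup∘tabulate f i)

  g≡ : ∀ j → g j ≡ lookup (tabulate g) j
  g≡ j = sym (lookup∘tabulate g j)

  row₁↑ : StrictlyIncreasing (lookup (tabulate f))
  row₁↑ i j i<j = subst₂ _<_ (f≡ i) (f≡ j) (f↑ i j i<j)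

  row₂↑ : StrictlyIncreasing (lookup (tabulate g))
  row₂↑ i j i<j = subst₂ _<_ (g≡ i) (g≡ j) (g↑ i j i<j)

  range : ∀ p → 1 ≤ lookup (tabulate f ++ tabulate g) p × lookup (tabulate f ++ tabulate g) p ≤ a + b
  range = lookup⁺ (++⁺ (tabulate⁺ {P = λ v → 1 ≤ v × v ≤ a + b} f-range) (tabulate⁺ g-range))

  injective : Injective _≡_ _≡_ (lookup (tabulate f ++ tabulate g))
  injective = ++-injective (tabulate f) (tabulate g)
    (strictlyIncreasing⇒injective row₁↑) (strictlyIncreasing⇒injective row₂↑)
    (λ i j → disjoint i j ∘ subst₂ _≡_ (sym (f≡ i)) (sym (g≡ j)))

module _ (r₁ : Vec ℕ a) (r₂ : Vec ℕ b) (syt : IsSYT a b r₁ r₂) where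

  IsSYT⇒row₁↑ : StrictlyIncreasing (lookup r₁)
  IsSYT⇒row₁↑ = proj₁ (proj₂ (proj₂ (proj₂ syt)))

  IsSYT⇒row₂↑ : StrictlyIncreasing (lookup r₂)
  IsSYT⇒row₂↑ = proj₁ (proj₂ (proj₂ (proj₂ (proj₂ syt))))

  IsSYT⇒row₁-range : ∀ i → 1 ≤ lookup r₁ i × lookup r₁ i ≤ a + b
  IsSYT⇒row₁-range i = subst (λ v → 1 ≤ v × v ≤ a + b) (lookup-++ˡ r₁ r₂ i) (proj₁ syt (i ↑ˡ b))

  IsSYT⇒row₂-range : ∀ j → 1 ≤ lookup r₂ j × lookup r₂ j ≤ a + b
  IsSYT⇒row₂-range j = subst (λ v → 1 ≤ v × v ≤ a + b) (lookup-++ʳ r₁ r₂ j) (proj₁ syt (a ↑ʳ j))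

  IsSYT⇒rows-disjoint : ∀ i j → lookup r₁ i ≢ lookup r₂ j
  IsSYT⇒rows-disjoint = ++-injective⇒disjoint r₁ r₂ (proj₁ (proj₂ syt) _ _)

  IsSYT⇒location : ∀ {v} → 1 ≤ v → v ≤ a + b → (∃ λ i → lookup r₁ i ≡ v) ⊎ (∃ λ j → lookup r₂ j ≡ v)
  IsSYT⇒location 1≤v v≤a+b = ++-location r₁ r₂ (proj₁ (proj₂ (proj₂ syt)) _ 1≤v v≤a+b)

  IsSYT⇒row₂≤row₁⇒< : ∀ i j → lookup r₂ j ≤ lookup r₁ i → toℕ j < toℕ i
  IsSYT⇒row₂≤row₁⇒< i j r₂ⱼ≤r₁ᵢ = ≰⇒> λ i≤j → <⇒≱ (r₁ᵢ<r₂ⱼ i≤j) r₂ⱼ≤r₁ᵢ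
    where
    r₁ᵢ<r₂ⱼ : toℕ i ≤ toℕ j → lookup r₁ i < lookup r₂ j
    r₁ᵢ<r₂ⱼ i≤j = <-≤-trans
      (proj₂ (proj₂ (proj₂ (proj₂ (proj₂ syt)))) i i′ (sym (Finₚ.toℕ-fromℕ< i<b)))
      (strictlyIncreasing⇒nondecreasing IsSYT⇒row₂↑ i′ j (≤-trans (≤-reflexive (Finₚ.toℕ-fromℕ< i<b)) i≤j))
      where
      i<b = ≤-<-trans i≤j (Finₚ.toℕ<n j)
      i′ = fromℕ< i<b

  -- rank numbers the cells holding 1, …, rᵢ injectively by values below 2i + 1 (0-based i).
  IsSYT⇒row₁≤ : ∀ i → lookup r₁ i ≤ suc (toℕ i + toℕ i)
  IsSYT⇒row₁≤ i = injective∧bounded⇒≤ (λ v → rank (location v)) rank∘location-injective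
    (λ v → rank< (Finₚ.toℕ<n v) (location v))
    where
    c = toℕ i
    r = lookup r₁ i

    Location : ℕ → Set
    Location v = (∃ λ i′ → lookup r₁ i′ ≡ v) ⊎ (∃ λ j → lookup r₂ j ≡ v)

    location : (v : Fin r) → Location (suc (toℕ v))
    location v = IsSYT⇒location (s≤s z≤n) (≤-trans (Finₚ.toℕ<n v) (proj₂ (IsSYT⇒row₁-range i)))

    rank : ∀ {v} → Location v → ℕ
    rank (inj₁ (i′ , _)) = toℕ i′
    rank (inj₂ (j , _))  = suc c + toℕ j

    row₁-column≤ : ∀ {v i′} → v ≤ r → lookup r₁ i′ ≡ v → toℕ i′ ≤ c
    row₁-column≤ v≤r eq = strictlyIncreasing-cancel-≤ IsSYT⇒row₁↑ _ i (subst (_≤ r) (sym eq) v≤r)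

    rank< : ∀ {v} → v ≤ r → (ℓ : Location v) → rank ℓ < suc c + c
    rank< v≤r (inj₁ (_ , eq)) = ≤-trans (s≤s (row₁-column≤ v≤r eq)) (m≤m+n (suc c) c)
    rank< v≤r (inj₂ (j , eq)) = +-monoʳ-< (suc c) (IsSYT⇒row₂≤row₁⇒< i j (subst (_≤ r) (sym eq) v≤r))

    rank-injective : ∀ {v w} → v ≤ r → w ≤ r → (ℓ : Location v) (ℓ′ : Location w) → rank ℓ ≡ rank ℓ′ → v ≡ w
    rank-injective _ _ (inj₁ (_ , e₁)) (inj₁ (_ , e₂)) eq =
      trans (sym e₁) (trans (cong (lookup r₁) (Finₚ.toℕ-injective eq)) e₂)
    rank-injective _ _ (inj₂ (_ , e₁)) (inj₂ (_ , e₂)) eq =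
      trans (sym e₁) (trans (cong (lookup r₂) (Finₚ.toℕ-injective (+-cancelˡ-≡ (suc c) _ _ eq))) e₂)
    rank-injective v≤r _ (inj₁ (_ , e₁)) (inj₂ _) eq =
      contradiction (≤-trans (m≤m+n (suc c) _) (≤-reflexive (sym eq))) (≤⇒≯ (row₁-column≤ v≤r e₁))
    rank-injective _ w≤r (inj₂ _) (inj₁ (_ , e₂)) eq =
      contradiction (≤-trans (m≤m+n (suc c) _) (≤-reflexive eq)) (≤⇒≯ (row₁-column≤ w≤r e₂))

    rank∘location-injective : Injective _≡_ _≡_ (λ v → rank (location v))
    rank∘location-injective {v} {w} eq = Finₚ.toℕ-injective (suc-injective
      (rank-injective (Finₚ.toℕ<n v) (Finₚ.toℕ<n w) (location v) (location w) eq))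

IsSYT⇒row₂⊆ : (r₁ : Vec ℕ a) (r₂ r₂′ : Vec ℕ b) → IsSYT a b r₁ r₂ → IsSYT a b r₁ r₂′ →
              ∀ j → ∃ λ j′ → lookup r₂′ j′ ≡ lookup r₂ j
IsSYT⇒row₂⊆ r₁ r₂ r₂′ syt syt′ j with IsSYT⇒row₂-range r₁ r₂ syt j
... | 1≤r₂ⱼ , r₂ⱼ≤a+b with IsSYT⇒location r₁ r₂′ syt′ 1≤r₂ⱼ r₂ⱼ≤a+b
...   | inj₁ (i , r₁ᵢ≡r₂ⱼ) = contradiction r₁ᵢ≡r₂ⱼ (IsSYT⇒rows-disjoint r₁ r₂ syt i j)
...   | inj₂ found         = found

IsSYT-row₂-unique : (r₁ : Vec ℕ a) (r₂ r₂′ : Vec ℕ b) → IsSYT a b r₁ r₂ → IsSYT a b r₁ r₂′ → r₂ ≡ r₂′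
IsSYT-row₂-unique r₁ r₂ r₂′ syt syt′ = Pointwise-≡⇒≡ (ext (sameImage⇒≗
  (IsSYT⇒row₂↑ r₁ r₂ syt) (IsSYT⇒row₂↑ r₁ r₂′ syt′)
  (IsSYT⇒row₂⊆ r₁ r₂ r₂′ syt syt′) (IsSYT⇒row₂⊆ r₁ r₂′ r₂ syt′ syt)))

row₁ : Vec ℕ n → Fin n → ℕ
row₁ x i = toℕ i + lookup x i

row₂ : Vec ℕ n → Fin b → ℕ
row₂ x j = suc (toℕ j) + countAtMost (suc (toℕ j)) x

tableau : ∀ b → Vec ℕ n → Vec ℕ n × Vec ℕ b
tableau b x = tabulate (row₁ x) , tabulate (row₂ x)

module _ (x : Vec ℕ n) (x↑ : Nondecreasing (lookup x)) (i : Fin n) (j : Fin b) where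

  row₁<row₂ : lookup x i ≤ suc (toℕ j) → row₁ x i < row₂ x j
  row₁<row₂ xᵢ≤t = begin-strict
    toℕ i + lookup x i   <⟨ +-mono-<-≤ i<count xᵢ≤t ⟩
    countAtMost t x + t  ≡⟨ +-comm (countAtMost t x) t ⟩
    t + countAtMost t x  ∎
    where
    open ≤-Reasoning
    t = suc (toℕ j)
    i<count = holdsUpTo⇒<count (_≤? t) x i (λ k k≤i → ≤-trans (x↑ k i k≤i) xᵢ≤t)

  row₂<row₁ : suc (toℕ j) < lookup x i → row₂ x j < row₁ x i
  row₂<row₁ t<xᵢ = begin-strict
    t + countAtMost t x  <⟨ +-mono-<-≤ t<xᵢ count≤i ⟩
    lookup x i + toℕ i   ≡⟨ +-comm (lookup x i) (toℕ i) ⟩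
    toℕ i + lookup x i   ∎
    where
    open ≤-Reasoning
    t = suc (toℕ j)
    count≤i = failsFrom⇒count≤ (_≤? t) x (toℕ i) (λ k i≤k → <⇒≱ (<-≤-trans t<xᵢ (x↑ i k i≤k)))

row₂-strictlyIncreasing : (x : Vec ℕ n) → StrictlyIncreasing (row₂ {b = b} x)
row₂-strictlyIncreasing x i j i<j = +-mono-<-≤ (s≤s i<j)
  (count-monotone (_≤? suc (toℕ i)) (_≤? suc (toℕ j)) (λ y≤ → ≤-trans y≤ (s≤s (<⇒≤ i<j))) x)

tableau-isSYT : {x : Vec ℕ n} → IsNDPF x → (∀ i → lookup x i ≤ suc b) →
                IsSYT n b (tabulate (row₁ x)) (tabulate (row₂ x))
tableau-isSYT {n} {b} {x} (x≥1 , x-park , x↑) x≤ = tabulate-isSYT row₁-range row₂-range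
  (+toℕ-strictlyIncreasing x↑) (row₂-strictlyIncreasing x) disjoint columns
  where
  row₁-range : ∀ i → 1 ≤ row₁ x i × row₁ x i ≤ n + b
  row₁-range i = ≤-trans (x≥1 i) (m≤n+m _ _) ,
                 s≤s⁻¹ (≤-trans (+-mono-≤ (Finₚ.toℕ<n i) (x≤ i)) (≤-reflexive (+-suc n b)))

  row₂-range : ∀ j → 1 ≤ row₂ x j × row₂ x j ≤ n + b
  row₂-range j = s≤s z≤n ,
                 ≤-trans (+-mono-≤ (Finₚ.toℕ<n j) (count≤n (_≤? _) x)) (≤-reflexive (+-comm b n))

  disjoint : ∀ i j → row₁ x i ≢ row₂ x j
  disjoint i j with lookup x i ≤? suc (toℕ j)
  ... | yes xᵢ≤t = <⇒≢ (row₁<row₂ x x↑ i j xᵢ≤t)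
  ... | no  xᵢ≰t = >⇒≢ (row₂<row₁ x x↑ i j (≰⇒> xᵢ≰t))

  columns : ∀ i j → toℕ i ≡ toℕ j → row₁ x i < row₂ x j
  columns i j i≡j = row₁<row₂ x x↑ i j (subst (λ c → lookup x i ≤ suc c) i≡j (x-park i))

last≡lookup-fromℕ : {A : Set} (xs : Vec A (suc n)) → last xs ≡ lookup xs (fromℕ n)
last≡lookup-fromℕ (x ∷ [])     = refl
last≡lookup-fromℕ (x ∷ y ∷ ys) = last≡lookup-fromℕ (y ∷ ys)

Last≤⇒lookup≤ : ∀ {k} (x : Vec ℕ (suc n)) → Nondecreasing (lookup x) → Last≤ x k → ∀ i → lookup x i ≤ k
Last≤⇒lookup≤ x@(_ ∷ _) x↑ xₙ≤k i =
  ≤-trans (x↑ i (fromℕ _) (Finₚ.≤fromℕ i)) (subst (_≤ _) (last≡lookup-fromℕ x) xₙ≤k)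

σ : PFup≤ (suc n) (suc b) → SYT (suc n) b
σ {b = b} (x , ndpf , xₙ≤k) = tableau b x , tableau-isSYT {x = x} ndpf (Last≤⇒lookup≤ x (proj₂ (proj₂ ndpf)) xₙ≤k)

tableau-injective : {x y : Vec ℕ n} → tableau b x ≡ tableau b y → x ≡ y
tableau-injective {x = x} {y} eq = Pointwise-≡⇒≡ (ext λ i → +-cancelˡ-≡ (toℕ i) _ _ (begin
  row₁ x i                     ≡⟨ lookup∘tabulate (row₁ x) i ⟨
  lookup (tabulate (row₁ x)) i ≡⟨ cong (λ t → lookup (proj₁ t) i) eq ⟩
  lookup (tabulate (row₁ y)) i ≡⟨ lookup∘tabulate (row₁ y) i ⟩
  row₁ y i                     ∎))
  where open ≡-Reasoning

fromRow₁ : Vec ℕ n → Vec ℕ n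
fromRow₁ r = tabulate λ i → lookup r i ∸ toℕ i

module _ (r₁ : Vec ℕ (suc n)) (r₂ : Vec ℕ b) (syt : IsSYT (suc n) b r₁ r₂) where

  private
    r₁↑ = IsSYT⇒row₁↑ r₁ r₂ syt

    lookup-fromRow₁ : ∀ i → lookup (fromRow₁ r₁) i ≡ lookup r₁ i ∸ toℕ i
    lookup-fromRow₁ = lookup∘tabulate _

    1+toℕ≤r₁ : ∀ i → 1 + toℕ i ≤ lookup r₁ i
    1+toℕ≤r₁ i = ≤-trans (+-monoˡ-≤ (toℕ i) (proj₁ (IsSYT⇒row₁-range r₁ r₂ syt zero)))
                         (strictlyIncreasing-head+toℕ≤ r₁↑ i)

  row₁-fromRow₁ : ∀ i → row₁ (fromRow₁ r₁) i ≡ lookup r₁ i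
  row₁-fromRow₁ i = trans (cong (toℕ i +_) (lookup-fromRow₁ i)) (m+[n∸m]≡n (<⇒≤ (1+toℕ≤r₁ i)))

  fromRow₁-isNDPF : IsNDPF (fromRow₁ r₁)
  fromRow₁-isNDPF = positive , parking , nondecreasing
    where
    positive : ∀ i → 1 ≤ lookup (fromRow₁ r₁) i
    positive i = subst (1 ≤_) (sym (lookup-fromRow₁ i)) (m+n≤o⇒m≤o∸n 1 (1+toℕ≤r₁ i))

    parking : ∀ i → lookup (fromRow₁ r₁) i ≤ suc (toℕ i)
    parking i = subst (_≤ suc (toℕ i)) (sym (lookup-fromRow₁ i)) (m≤n+o⇒m∸n≤o (lookup r₁ i) (toℕ i)
      (≤-trans (IsSYT⇒row₁≤ r₁ r₂ syt i) (≤-reflexive (sym (+-suc (toℕ i) (toℕ i))))))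

    nondecreasing : Nondecreasing (lookup (fromRow₁ r₁))
    nondecreasing i j i≤j = subst₂ _≤_ (sym (lookup-fromRow₁ i)) (sym (lookup-fromRow₁ j))
      (∸toℕ-nondecreasing r₁↑ i j i≤j)

  fromRow₁-Last≤ : Last≤ (fromRow₁ r₁) (suc b)
  fromRow₁-Last≤ = subst (_≤ suc b) (sym (trans (last≡lookup-fromℕ (fromRow₁ r₁)) (lookup-fromRow₁ (fromℕ n))))
    (m≤n+o⇒m∸n≤o (lookup r₁ (fromℕ n)) (toℕ (fromℕ n)) (begin
      lookup r₁ (fromℕ n)      ≤⟨ proj₂ (IsSYT⇒row₁-range r₁ r₂ syt (fromℕ n)) ⟩
      suc n + b                ≡⟨ +-suc n b ⟨
      n + suc b                ≡⟨ cong (_+ suc b) (Finₚ.toℕ-fromℕ n) ⟨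
      toℕ (fromℕ n) + suc b    ∎))
    where open ≤-Reasoning

fromSYT : SYT (suc n) b → PFup≤ (suc n) (suc b)
fromSYT ((r₁ , r₂) , syt) = fromRow₁ r₁ , fromRow₁-isNDPF r₁ r₂ syt , fromRow₁-Last≤ r₁ r₂ syt

tableau∘fromSYT : (t : SYT (suc n) b) → tableau b (proj₁ (fromSYT t)) ≡ proj₁ t
tableau∘fromSYT {n} {b} t@((r₁ , r₂) , syt) = cong₂ _,_ row₁≡r₁
  (IsSYT-row₂-unique r₁ row₂′ r₂ (subst (λ r → IsSYT (suc n) b r row₂′) row₁≡r₁ (proj₂ (σ (fromSYT t)))) syt)
  where
  row₂′ : Vec ℕ b
  row₂′ = tabulate (row₂ (fromRow₁ r₁))

  row₁≡r₁ : tabulate (row₁ (fromRow₁ r₁)) ≡ r₁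
  row₁≡r₁ = Pointwise-≡⇒≡ (ext λ i → trans (lookup∘tabulate (row₁ (fromRow₁ r₁)) i) (row₁-fromRow₁ r₁ r₂ syt i))

proposition4p22 : (n k : ℕ) → 1 ≤ n → 1 ≤ k → k ≤ n →
    Bijection (PFup≤-setoid n k) (SYT-setoid n (k ∸ 1))
proposition4p22 (suc n) (suc b) _ _ _ = record
  { to        = σ
  ; cong      = cong (tableau b)
  ; bijective = tableau-injective ,
                λ t → fromSYT t , λ x≈ → trans (cong (tableau b) x≈) (tableau∘fromSYT t)
  }
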